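{- Let $(b_1,\dots,b_m)$ be a vector of $m>1$ integers greater than $1$, sorted in nondecreasing order, that is not equal to any of the vectors $(2,n)$ with $n\ge2$, $(3,3)$, $(3,4)$, or $(2,2,2)$. Then $$\prod_{j=1}^m b_j!\le\Big(\sum_{j=1}^m b_j-m\Big)!,$$ and the inequality is strict unless $(b_1,\dots,b_m)$ equals $(2,2,3)$ or $(3,5)$. -}

module Defs where

open import Data.Nat using (ℕ; _≤_; _<_; _∸_; _!)
open import Data.List using (List; []; _∷_; map; length)
open import Data.Nat.ListAction using (product; sum)
open import Data.List.Relation.Unary.All using (All)
open import Data.List.Relation.Unary.Linked using (Linked)
open import Relation.Binary.PropositionalEquality using (_≡_; _≢_)
open import Data.Product using (_×_)

SortedND : List ℕ → Set
SortedND = Linked _≤_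

Excluded : List ℕ → Set
Excluded bs = (∀ n → 2 ≤ n → bs ≢ 2 ∷ n ∷ [])
            × bs ≢ 3 ∷ 3 ∷ []
            × bs ≢ 3 ∷ 4 ∷ []
            × bs ≢ 2 ∷ 2 ∷ 2 ∷ []

prodFact : List ℕ → ℕ
prodFact bs = product (map (λ b → b !) bs)

rhsFact : List ℕ → ℕ
rhsFact bs = (sum bs ∸ length bs) !

-- Write e = ∑ (b_j − 1). Removing the first entry b of the list, the rest has excess e' ≥ 2,
-- and b! e'! < (b − 1 + e')! because (e'+1)⋯(e'+b−1) outgrows 2⋅3⋯b as soon as e' ≥ 2.
-- So the inequality propagates strictly from the tail, by induction, unless the tail is itself
-- one of the exceptional vectors; those tails, and the vectors of length two, are checked
-- directly, where (b, c) with 4 ≤ b ≤ c needs the sharper b! c! < (b + c − 2)!.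
module Submission where

open import Defs
open import Data.Nat using (ℕ; suc; pred; _+_; _*_; _∸_; _!; _≤_; _<_; _≤′_; ≤′-refl; ≤′-step; z≤n; s≤s; _≟_)
open import Data.Nat.Properties
open import Data.Nat.ListAction using (sum)
open import Data.List using (List; []; _∷_; length; map)
open import Data.List.Properties using (≡-dec; ∷-injectiveˡ)
open import Data.List.Relation.Unary.All as All using (All; []; _∷_)
open import Data.List.Relation.Unary.Linked using ([-]; _∷_)
open import Data.Product using (_×_; _,_; proj₁; ∃)
open import Data.Empty using (⊥-elim)
open import Data.Unit using (tt)
open import Relation.Nullary using (Dec; yes; no; ¬_)
open import Relation.Binary.PropositionalEquality using (_≡_; _≢_; refl; sym; trans; cong; subst; subst₂; module ≡-Reasoning)

m<1+n⇒m*n!<[1+n]! : ∀ {m n} → m < suc n → m * n ! < suc n !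
m<1+n⇒m*n!<[1+n]! {n = n} m<1+n = *-monoˡ-< (n !) {{n !≢0}} m<1+n

!*!<!-suc : ∀ {a n q} → a ≤ n → a ! * q ! < n ! → suc a ! * q ! < suc n !
!*!<!-suc {a} {n} {q} a≤n a!q!<n! = begin-strict
  suc a ! * q !        ≡⟨ *-assoc (suc a) (a !) (q !) ⟩
  suc a * (a ! * q !)  <⟨ *-monoʳ-< (suc a) a!q!<n! ⟩
  suc a * n !          ≤⟨ *-monoˡ-≤ (n !) (s≤s a≤n) ⟩
  suc n !              ∎
  where open ≤-Reasoning

!*!<!-mono : ∀ {a b d q} → 0 < d → a ≤′ b → suc a ! * q ! < (a + d) ! → suc b ! * q ! < (b + d) !
!*!<!-mono 0<d ≤′-refl base = base
!*!<!-mono {q = q} 0<d (≤′-step {n = b} a≤′b) base =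
  !*!<!-suc {q = q} (m<m+n b 0<d) (!*!<!-mono {q = q} 0<d a≤′b base)

[1+a]!*q!<[a+q]! : ∀ {a q} → 1 ≤ a → 2 ≤ q → suc a ! * q ! < (a + q) !
[1+a]!*q!<[a+q]! {q = q} 1≤a 2≤q = !*!<!-mono {q = q} (<⇒≤ 2≤q) (≤⇒≤′ 1≤a) (m<1+n⇒m*n!<[1+n]! (s≤s 2≤q))

[1+a]!*[1+n]!<[a+n]! : ∀ {a n} → 3 ≤ a → 3 ≤ n → suc a ! * suc n ! < (a + n) !
[1+a]!*[1+n]!<[a+n]! {n = n} 3≤a 3≤n = !*!<!-mono {q = suc n} (≤-trans (s≤s z≤n) 3≤n) (≤⇒≤′ 3≤a) 4!*[1+n]!<[3+n]!
  where
  open ≤-Reasoning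
  24<[3+n]*[2+n] : 24 < (3 + n) * (2 + n)
  24<[3+n]*[2+n] = <-≤-trans (<ᵇ⇒< 24 30 tt) (*-mono-≤ (s≤s (s≤s (s≤s 3≤n))) (s≤s (s≤s 3≤n)))
  4!*[1+n]!<[3+n]! : 4 ! * suc n ! < (3 + n) !
  4!*[1+n]!<[3+n]! = begin-strict
    24 * suc n !                 <⟨ *-monoˡ-< (suc n !) {{suc n !≢0}} 24<[3+n]*[2+n] ⟩
    (3 + n) * (2 + n) * suc n !  ≡⟨ *-assoc (3 + n) (2 + n) (suc n !) ⟩
    (3 + n) !                    ∎

excess : List ℕ → ℕ
excess bs = sum (map pred bs)

sum≡excess+length : ∀ {bs} → All (0 <_) bs → sum bs ≡ excess bs + length bs
sum≡excess+length [] = refl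
sum≡excess+length {suc b ∷ bs} (_ ∷ 0<bs) = begin
  suc b + sum bs                     ≡⟨ cong (suc b +_) (sum≡excess+length 0<bs) ⟩
  suc (b + (excess bs + length bs))  ≡⟨ cong suc (+-assoc b (excess bs) (length bs)) ⟨
  suc (b + excess bs + length bs)    ≡⟨ +-suc (b + excess bs) (length bs) ⟨
  b + excess bs + suc (length bs)    ∎
  where open ≡-Reasoning

rhsFact≡excess! : ∀ {bs} → All (0 <_) bs → rhsFact bs ≡ excess bs !
rhsFact≡excess! {bs} 0<bs =
  cong _! (trans (cong (_∸ length bs) (sum≡excess+length 0<bs)) (m+n∸n≡m (excess bs) (length bs)))

length≤excess : ∀ {bs} → All (1 <_) bs → length bs ≤ excess bs
length≤excess [] = z≤n
length≤excess (s≤s (s≤s _) ∷ 1<bs) = +-mono-≤ (s≤s z≤n) (length≤excess 1<bs)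

prodFact-pair : ∀ b c → prodFact (b ∷ c ∷ []) ≡ b ! * c !
prodFact-pair b c = cong (b ! *_) (*-identityʳ (c !))

excess-pair : ∀ b c → excess (b ∷ c ∷ []) ≡ pred b + pred c
excess-pair b c = cong (pred b +_) (+-identityʳ (pred c))

FactorialBound : List ℕ → Set
FactorialBound bs = prodFact bs ≤ excess bs !
                  × (bs ≢ 2 ∷ 2 ∷ 3 ∷ [] × bs ≢ 3 ∷ 5 ∷ [] → prodFact bs < excess bs !)

<⇒FactorialBound : ∀ {bs} → prodFact bs < excess bs ! → FactorialBound bs
<⇒FactorialBound p<e! = <⇒≤ p<e! , λ _ → p<e!

cons-< : ∀ {b ts} → 1 < b → 2 ≤ excess ts → prodFact ts ≤ excess ts ! →
         prodFact (b ∷ ts) < excess (b ∷ ts) !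
cons-< {suc a} {ts} (s≤s 1≤a) 2≤e p≤e! =
  ≤-<-trans (*-monoʳ-≤ (suc a !) p≤e!) ([1+a]!*q!<[a+q]! {q = excess ts} 1≤a 2≤e)

pair-< : ∀ b c → b ! * c ! < (pred b + pred c) ! → prodFact (b ∷ c ∷ []) < excess (b ∷ c ∷ []) !
pair-< b c = subst₂ _<_ (sym (prodFact-pair b c)) (cong _! (sym (excess-pair b c)))

data Exceptional : List ℕ → Set where
  [2,n]   : ∀ n → Exceptional (2 ∷ n ∷ [])
  [3,3]   : Exceptional (3 ∷ 3 ∷ [])
  [3,4]   : Exceptional (3 ∷ 4 ∷ [])
  [2,2,2] : Exceptional (2 ∷ 2 ∷ 2 ∷ [])

[2,n]? : (bs : List ℕ) → Dec (∃ λ n → bs ≡ 2 ∷ n ∷ [])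
[2,n]? [] = no λ ()
[2,n]? (b ∷ []) = no λ ()
[2,n]? (b ∷ c ∷ d ∷ bs) = no λ ()
[2,n]? (b ∷ c ∷ []) with b ≟ 2
... | yes refl = yes (c , refl)
... | no b≢2 = no λ (_ , eq) → b≢2 (∷-injectiveˡ eq)

exceptional? : (bs : List ℕ) → Dec (Exceptional bs)
exceptional? bs with [2,n]? bs | ≡-dec _≟_ bs (3 ∷ 3 ∷ []) | ≡-dec _≟_ bs (3 ∷ 4 ∷ []) | ≡-dec _≟_ bs (2 ∷ 2 ∷ 2 ∷ [])
... | yes (n , refl) | _ | _ | _ = yes ([2,n] n)
... | _ | yes refl | _ | _ = yes [3,3]
... | _ | _ | yes refl | _ = yes [3,4]
... | _ | _ | _ | yes refl = yes [2,2,2]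
... | no ≢[2,n] | no ≢[3,3] | no ≢[3,4] | no ≢[2,2,2] = no λ where
  ([2,n] n) → ≢[2,n] (n , refl)
  [3,3] → ≢[3,3] refl
  [3,4] → ≢[3,4] refl
  [2,2,2] → ≢[2,2,2] refl

¬Exceptional⇒Excluded : ∀ {bs} → ¬ Exceptional bs → Excluded bs
¬Exceptional⇒Excluded ¬e =
  (λ { n _ refl → ¬e ([2,n] n) }) , (λ { refl → ¬e [3,3] }) , (λ { refl → ¬e [3,4] }) , (λ { refl → ¬e [2,2,2] })

[2,2,n]-< : ∀ {n} → 3 < n → prodFact (2 ∷ 2 ∷ n ∷ []) < excess (2 ∷ 2 ∷ n ∷ []) !
[2,2,n]-< {n@(suc _)} 3<n = begin-strict
  2 * prodFact (2 ∷ n ∷ [])    ≡⟨ cong (2 *_) (prodFact-pair 2 n) ⟩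
  2 * (2 * n !)                ≡⟨ *-assoc 2 2 (n !) ⟨
  4 * n !                      <⟨ m<1+n⇒m*n!<[1+n]! (s≤s 3<n) ⟩
  suc n !                      ≡⟨ cong (λ e → suc e !) (excess-pair 2 n) ⟨
  suc (excess (2 ∷ n ∷ [])) !  ∎
  where open ≤-Reasoning

exceptional-tail : ∀ {b ts} → All (1 <_) (b ∷ ts) → SortedND (b ∷ ts) → Excluded (b ∷ ts) →
                   Exceptional ts → FactorialBound (b ∷ ts)
exceptional-tail {0} (() ∷ _) _ _ _
exceptional-tail {1} (s≤s () ∷ _) _ _ _
exceptional-tail {2} (_ ∷ _ ∷ () ∷ []) _ _ ([2,n] 0)
exceptional-tail {2} (_ ∷ _ ∷ s≤s () ∷ []) _ _ ([2,n] 1)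
exceptional-tail {2} _ _ (_ , _ , _ , ≢[2,2,2]) ([2,n] 2) = ⊥-elim (≢[2,2,2] refl)
exceptional-tail {2} _ _ _ ([2,n] 3) = ≤ᵇ⇒≤ 24 24 tt , λ (≢[2,2,3] , _) → ⊥-elim (≢[2,2,3] refl)
exceptional-tail {2} _ _ _ ([2,n] (suc (suc (suc (suc k))))) = <⇒FactorialBound ([2,2,n]-< {4 + k} (s≤s (s≤s (s≤s (s≤s z≤n)))))
exceptional-tail {2} _ _ _ [3,3] = <⇒FactorialBound (<ᵇ⇒< 72 120 tt)
exceptional-tail {3} _ _ _ [3,3] = <⇒FactorialBound (<ᵇ⇒< 216 720 tt)
exceptional-tail {2} _ _ _ [3,4] = <⇒FactorialBound (<ᵇ⇒< 288 720 tt)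
exceptional-tail {3} _ _ _ [3,4] = <⇒FactorialBound (<ᵇ⇒< 864 5040 tt)
exceptional-tail {2} _ _ _ [2,2,2] = <⇒FactorialBound (<ᵇ⇒< 16 24 tt)
exceptional-tail {suc (suc (suc _))} _ (s≤s (s≤s ()) ∷ _) _ ([2,n] _)
exceptional-tail {suc (suc (suc _))} _ (s≤s (s≤s ()) ∷ _) _ [2,2,2]
exceptional-tail {suc (suc (suc (suc _)))} _ (s≤s (s≤s (s≤s ())) ∷ _) _ [3,3]
exceptional-tail {suc (suc (suc (suc _)))} _ (s≤s (s≤s (s≤s ())) ∷ _) _ [3,4]

pair-bound : ∀ {b c} → 1 < b → b ≤ c → Excluded (b ∷ c ∷ []) → FactorialBound (b ∷ c ∷ [])
pair-bound {0} () _ _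
pair-bound {1} (s≤s ()) _ _
pair-bound {2} {c} _ 2≤c (≢[2,n] , _) = ⊥-elim (≢[2,n] c 2≤c refl)
pair-bound {3} {0} _ () _
pair-bound {3} {1} _ (s≤s ()) _
pair-bound {3} {2} _ (s≤s (s≤s ())) _
pair-bound {3} {3} _ _ (_ , ≢[3,3] , _) = ⊥-elim (≢[3,3] refl)
pair-bound {3} {4} _ _ (_ , _ , ≢[3,4] , _) = ⊥-elim (≢[3,4] refl)
pair-bound {3} {5} _ _ _ = ≤ᵇ⇒≤ 720 720 tt , λ (_ , ≢[3,5]) → ⊥-elim (≢[3,5] refl)
pair-bound {3} {suc (suc (suc (suc (suc (suc k)))))} _ _ _ =
  <⇒FactorialBound (pair-< 3 (6 + k) (m<1+n⇒m*n!<[1+n]! (s≤s (m≤m+n 6 k))))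
pair-bound {suc (suc (suc (suc i)))} {0} _ () _
pair-bound {suc (suc (suc (suc i)))} {suc n} _ (s≤s 3+i≤n) _ =
  <⇒FactorialBound (pair-< (4 + i) (suc n) ([1+a]!*[1+n]!<[a+n]! (m≤m+n 3 i) (≤-trans (m≤m+n 3 i) 3+i≤n)))

factorialBound : ∀ bs → 1 < length bs → All (1 <_) bs → SortedND bs → Excluded bs → FactorialBound bs
factorialBound [] ()
factorialBound (_ ∷ []) (s≤s ())
factorialBound (b ∷ c ∷ []) _ (1<b ∷ _) (b≤c ∷ [-]) excl = pair-bound 1<b b≤c excl
factorialBound (b ∷ ts@(_ ∷ _ ∷ _)) _ 1<bts@(1<b ∷ 1<ts) sorted@(_ ∷ sorted-ts) excl with exceptional? ts
... | yes exc = exceptional-tail 1<bts sorted excl exc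
... | no ¬exc = <⇒FactorialBound (cons-< {ts = ts} 1<b 2≤excess-ts (proj₁ ts-bound))
  where
  2≤excess-ts : 2 ≤ excess ts
  2≤excess-ts = ≤-trans (s≤s (s≤s z≤n)) (length≤excess 1<ts)
  ts-bound : FactorialBound ts
  ts-bound = factorialBound ts (s≤s (s≤s z≤n)) 1<ts sorted-ts (¬Exceptional⇒Excluded ¬exc)

lemma2p7 : (bs : List ℕ) → 1 < length bs → All (1 <_) bs → SortedND bs → Excluded bs →
    (prodFact bs ≤ rhsFact bs)
    × ((bs ≢ 2 ∷ 2 ∷ 3 ∷ [] × bs ≢ 3 ∷ 5 ∷ []) → prodFact bs < rhsFact bs)
lemma2p7 bs 1<m 1<bs sorted excl =
  subst (λ r → prodFact bs ≤ r × (bs ≢ 2 ∷ 2 ∷ 3 ∷ [] × bs ≢ 3 ∷ 5 ∷ [] → prodFact bs < r))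
        (sym (rhsFact≡excess! (All.map <⇒≤ 1<bs)))
        (factorialBound bs 1<m 1<bs sorted excl)
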